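{- Fix an integer $r \ge 4$. There exists $n_0 = n_0(r)$ such that if $G$ is a $K_{r+1}$-free graph on $n \ge n_0$ vertices with $\nu(P_3,G) = \mathrm{ex}(n,P_3,K_{r+1})$, then for every vertex $v \in V(G)$, \[ \nu_G(v,P_3) \ge \left(\mathrm{OPT}_r(P_3) - \frac{1}{r^{10}}\right)\binom{n-1}{3} - \frac{1}{r^4}n^3. \]
   Context: All graphs are finite and simple. $P_3$ is the path with 3 edges (4 vertices). For graphs $T,G$, $\nu(T,G)$ is the number of (not necessarily induced) subgraphs of $G$ isomorphic to $T$, $\nu_G(v,T)$ is the number of such subgraphs containing the vertex $v$, and $d(T,G) = \nu(T,G)\binom{|V(G)|}{|V(T)|}^{ -1}$. A graph is $K_{r+1}$-free if it contains no subgraph isomorphic to $K_{r+1}$. $\mathrm{ex}(n,P_3,K_{r+1})$ is the maximum of $\nu(P_3,G)$ over all $K_{r+1}$-free graphs $G$ on $n$ vertices. Letting $\mathcal{F}_{n,r}$ be the family of $K_{r+1}$-free graphs on $n$ vertices, $\mathrm{OPT}_r(P_3) = \lim_{n\to\infty} \max_{G \in \mathcal{F}_{n,r}} d(P_3,G)$. -}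

module Defs where

open import Data.Bool using (Bool; true; false; _∧_; if_then_else_)
open import Data.Nat using (ℕ; zero; suc; _≤_; _<_; _^_; _∸_)
open import Data.Nat.Combinatorics using (_C_)
open import Data.Fin using (Fin; _≟_)
open import Data.Fin.Properties using ()
open import Data.List using (List; map; allFin)
open import Data.Nat.ListAction using (sum)
open import Data.Product using (Σ; ∃; _×_; _,_)
open import Data.Integer using (+_)
open import Data.Rational using (ℚ; 0ℚ; _/_; _*_; _+_; _-_) renaming (_≤_ to _≤ℚ_; _<_ to _<ℚ_)
open import Function.Definitions using (Injective)
open import Relation.Binary.PropositionalEquality using (_≡_)
open import Relation.Nullary using (¬_; does)

record Graph (n : ℕ) : Set where
  field
    adj   : Fin n → Fin n → Bool
    sym   : ∀ x y → adj x y ≡ adj y x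
    irrefl : ∀ x → adj x x ≡ false
open Graph public

KFree : (r : ℕ) {n : ℕ} → Graph n → Set
KFree r {n} G =
  ¬ (Σ (Fin (suc r) → Fin n) λ f →
       Injective _≡_ _≡_ f × (∀ i j → ¬ (i ≡ j) → adj G (f i) (f j) ≡ true))

ΣFin : (n : ℕ) → (Fin n → ℕ) → ℕ
ΣFin n f = sum (map f (allFin n))

_≢ᵇ_ : {n : ℕ} → Fin n → Fin n → Bool
x ≢ᵇ y = if does (x ≟ y) then false else true

isPath : {n : ℕ} → Graph n → Fin n → Fin n → Fin n → Fin n → Bool
isPath G a b c d =
  (a ≢ᵇ b) ∧ (a ≢ᵇ c) ∧ (a ≢ᵇ d) ∧ (b ≢ᵇ c) ∧ (b ≢ᵇ d) ∧ (c ≢ᵇ d)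
  ∧ adj G a b ∧ adj G b c ∧ adj G c d

bool→ℕ : Bool → ℕ
bool→ℕ true = 1
bool→ℕ false = 0

-- number of ordered 4-tuples (a,b,c,d) forming a path a-b-c-d (each copy of P_3 counted twice)
orderedP3 : {n : ℕ} → Graph n → ℕ
orderedP3 {n} G = ΣFin n λ a → ΣFin n λ b → ΣFin n λ c → ΣFin n λ d →
  bool→ℕ (isPath G a b c d)

orderedP3at : {n : ℕ} → Graph n → Fin n → ℕ
orderedP3at {n} G v = ΣFin n λ a → ΣFin n λ b → ΣFin n λ c → ΣFin n λ d →
  bool→ℕ (isPath G a b c d ∧
          (if does (v ≟ a) then true else if does (v ≟ b) then true
           else if does (v ≟ c) then true else does (v ≟ d)))

toℚ : ℕ → ℚ
toℚ m = + m / 1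

-- ν(P_3,G): each subgraph copy of P_3 (a path with 3 edges) corresponds to exactly
-- two ordered tuples (a,b,c,d),(d,c,b,a); we count in ℚ to avoid truncation issues.
νP3 : {n : ℕ} → Graph n → ℚ
νP3 G = toℚ (orderedP3 G) * (+ 1 / 2)

νP3at : {n : ℕ} → Graph n → Fin n → ℚ
νP3at G v = toℚ (orderedP3at G v) * (+ 1 / 2)

IsExtremal : (r : ℕ) {n : ℕ} → Graph n → Set
IsExtremal r {n} G = KFree r G × (∀ (H : Graph n) → KFree r H → νP3 H ≤ℚ νP3 G)

-- reciprocal of a natural number (only used for positive arguments)
recip : ℕ → ℚ
recip zero = 0ℚ
recip (suc k) = + 1 / suc k

-- "q < OPT_r(P_3)", where OPT_r(P_3) = lim_m max_{G ∈ F_{m,r}} d(P_3,G).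
-- Since the limit exists, q < OPT iff for some rational δ > 0, for all large m
-- there is a K_{r+1}-free graph H on m vertices with d(P_3,H) ≥ q + δ,
-- i.e. ν(P_3,H) ≥ (q + δ) * C(m,4).
BelowOPT : (r : ℕ) → ℚ → Set
BelowOPT r q = ∃ λ (δ : ℚ) → (0ℚ <ℚ δ) × ∃ λ (N : ℕ) → ∀ (m : ℕ) → N ≤ m →
  ∃ λ (H : Graph m) → KFree r H × ((q + δ) * toℚ (m C 4) ≤ℚ νP3 H)

{-# OPTIONS --safe #-}
module Submission where

-- Write T(G) for the number of ordered copies of P₃ in G and A(v) for those through v. Two
-- symmetrisation steps carry the proof, and both work for any fixed pattern in place of P₃.
-- Deletion: removing a vertex of below-average A never lowers the density T(G) / C(n,4), so a dense
-- K_{r+1}-free graph on m ≥ n vertices shrinks to one on n vertices that is at least as dense; hence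
-- an extremal G has T(G) ≥ 2 (q + δ) C(n,4) whenever q + δ is a density attained for all large m.
-- Cloning: replacing v by a non-adjacent twin of w keeps G K_{r+1}-free and changes A(v) into A(w)
-- up to the copies through both v and w, of which there are at most 16 n²; so in an extremal G every
-- A(v) is at least the average 4 T(G) / n minus 16 n². Together ν_G(v,P₃) ≥ (q + δ) C(n-1,3) - 8 n²,
-- and 8 n² ≤ n³ / r⁴ once n ≥ 8 r⁴.

module TupleCounting where
  open import Data.Bool using (Bool; true; false; _∧_; _∨_; not)
  open import Data.Bool.Properties using (∧-identityʳ; ∧-zeroʳ)
  open import Data.Fin using (Fin; zero; suc; punchIn; _≟_)
  open import Data.Fin.Properties using (punchInᵢ≢i)
  open import Data.Fin.Permutation using (Permutation; _⟨$⟩ʳ_)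
  open import Data.Nat using (ℕ; zero; suc; _+_; _*_; _^_; _≤_; z≤n; s≤s)
  open import Data.Nat.Properties hiding (_≟_)
  open import Data.Nat.Solver using (module +-*-Solver)
  open import Data.Product using (∃; _,_)
  open import Data.Vec using (Vec; []; _∷_; map)
  open import Data.Vec.Relation.Unary.All using (All; []; _∷_)
  open import Data.Vec.Relation.Unary.AllPairs using ([]; _∷_)
  open import Data.Vec.Relation.Unary.Unique.Propositional using (Unique)
  open import Function using (_∘_)
  open import Function.Definitions using (Injective)
  open import Relation.Binary.PropositionalEquality
  open import Relation.Nullary using (does; yes; no; ¬_; contradiction)
  open import Relation.Nullary.Decidable using (dec-true; dec-false)
  open import Algebra.Properties.Semiring.Sum +-*-semiring
    using (sum; sum-cong-≗; sum-remove; sum-permute; ∑-comm; ∑-distrib-+; *-distribˡ-sum; *-distribʳ-sum)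
  open import Defs using (bool→ℕ)
  open +-*-Solver

  private
    variable
      m n k : ℕ

  sum-mono-≤ : {f g : Fin n → ℕ} → (∀ i → f i ≤ g i) → sum f ≤ sum g
  sum-mono-≤ {zero}  f≤g = z≤n
  sum-mono-≤ {suc n} f≤g = +-mono-≤ (f≤g zero) (sum-mono-≤ (f≤g ∘ suc))

  sum-const : ∀ n c → sum {n} (λ _ → c) ≡ n * c
  sum-const zero    c = refl
  sum-const (suc n) c = cong (c +_) (sum-const n c)

  δ : Fin n → Fin n → ℕ
  δ v x = bool→ℕ (does (x ≟ v))

  sum-δ : (v : Fin n) → sum (δ v) ≡ 1
  sum-δ {suc n} v = begin
    sum (δ v)                     ≡⟨ sum-remove {i = v} (δ v) ⟩
    δ v v + sum (δ v ∘ punchIn v) ≡⟨ cong₂ _+_ (cong bool→ℕ (dec-true (v ≟ v) refl)) off-v ⟩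
    1 + 0                         ∎
    where
    open ≡-Reasoning
    off-v : sum (δ v ∘ punchIn v) ≡ 0
    off-v = trans (sum-cong-≗ λ j → cong bool→ℕ (dec-false (punchIn v j ≟ v) (punchInᵢ≢i v j)))
                  (trans (sum-const n 0) (*-zeroʳ n))

  tupleSum : ∀ k → (Vec (Fin n) k → ℕ) → ℕ
  tupleSum zero    f = f []
  tupleSum (suc k) f = sum λ x → tupleSum k (λ t → f (x ∷ t))

  tupleSum-cong : ∀ k {f g : Vec (Fin n) k → ℕ} → (∀ t → f t ≡ g t) → tupleSum k f ≡ tupleSum k g
  tupleSum-cong zero    f≗g = f≗g []
  tupleSum-cong (suc k) f≗g = sum-cong-≗ λ x → tupleSum-cong k (f≗g ∘ (x ∷_))

  tupleSum-mono-≤ : ∀ k {f g : Vec (Fin n) k → ℕ} → (∀ t → f t ≤ g t) → tupleSum k f ≤ tupleSum k g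
  tupleSum-mono-≤ zero    f≤g = f≤g []
  tupleSum-mono-≤ (suc k) f≤g = sum-mono-≤ λ x → tupleSum-mono-≤ k (f≤g ∘ (x ∷_))

  tupleSum-distrib-+ : ∀ k (f g : Vec (Fin n) k → ℕ) →
    tupleSum k (λ t → f t + g t) ≡ tupleSum k f + tupleSum k g
  tupleSum-distrib-+ zero    f g = refl
  tupleSum-distrib-+ (suc k) f g =
    trans (sum-cong-≗ λ x → tupleSum-distrib-+ k (λ t → f (x ∷ t)) (λ t → g (x ∷ t)))
          (∑-distrib-+ (λ x → tupleSum k (λ t → f (x ∷ t))) (λ x → tupleSum k (λ t → g (x ∷ t))))

  *-distribˡ-tupleSum : ∀ k c (f : Vec (Fin n) k → ℕ) → c * tupleSum k f ≡ tupleSum k (λ t → c * f t)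
  *-distribˡ-tupleSum zero    c f = refl
  *-distribˡ-tupleSum (suc k) c f =
    trans (*-distribˡ-sum c (λ x → tupleSum k (λ t → f (x ∷ t))))
          (sum-cong-≗ λ x → *-distribˡ-tupleSum k c (λ t → f (x ∷ t)))

  tupleSum-const : ∀ k c → tupleSum {n} k (λ _ → c) ≡ c * n ^ k
  tupleSum-const     zero    c = sym (*-identityʳ c)
  tupleSum-const {n} (suc k) c = begin
    sum {n} (λ _ → tupleSum {n} k (λ _ → c)) ≡⟨ sum-cong-≗ {n} (λ _ → tupleSum-const {n} k c) ⟩
    sum {n} (λ _ → c * n ^ k)                ≡⟨ sum-const n (c * n ^ k) ⟩
    n * (c * n ^ k)                          ≡⟨ solve 3 (λ n c p → n :* (c :* p) := c :* (n :* p)) refl n c (n ^ k) ⟩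
    c * n ^ suc k                            ∎
    where open ≡-Reasoning

  tupleSum-comm : ∀ k (f : Fin m → Vec (Fin n) k → ℕ) →
    sum (λ u → tupleSum k (f u)) ≡ tupleSum k (λ t → sum (λ u → f u t))
  tupleSum-comm zero    f = refl
  tupleSum-comm (suc k) f =
    trans (∑-comm (λ u x → tupleSum k (λ t → f u (x ∷ t))))
          (sum-cong-≗ λ x → tupleSum-comm k (λ u t → f u (x ∷ t)))

  tupleSum-permute : ∀ k (π : Permutation n n) (f : Vec (Fin n) k → ℕ) →
    tupleSum k f ≡ tupleSum k (λ t → f (map (π ⟨$⟩ʳ_) t))
  tupleSum-permute zero    π f = refl
  tupleSum-permute (suc k) π f =
    trans (sum-permute (λ x → tupleSum k (λ t → f (x ∷ t))) π)
          (sum-cong-≗ λ x → tupleSum-permute k π (λ t → f ((π ⟨$⟩ʳ x) ∷ t)))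

  tupleSum-linear : ∀ k (a : Fin n → ℕ) (f : Vec (Fin n) k → ℕ) (g : Fin n → Vec (Fin n) k → ℕ) →
    sum (λ x → tupleSum k (λ t → a x * f t + g x t)) ≡ sum a * tupleSum k f + sum (λ x → tupleSum k (g x))
  tupleSum-linear k a f g = begin
    sum (λ x → tupleSum k (λ t → a x * f t + g x t))
      ≡⟨ sum-cong-≗ (λ x → trans (tupleSum-distrib-+ k (λ t → a x * f t) (g x))
                                   (cong (_+ tupleSum k (g x)) (sym (*-distribˡ-tupleSum k (a x) f)))) ⟩
    sum (λ x → a x * tupleSum k f + tupleSum k (g x))
      ≡⟨ ∑-distrib-+ (λ x → a x * tupleSum k f) (λ x → tupleSum k (g x)) ⟩
    sum (λ x → a x * tupleSum k f) + sum (λ x → tupleSum k (g x))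
      ≡⟨ cong (_+ sum (λ x → tupleSum k (g x))) (*-distribʳ-sum (tupleSum k f) a) ⟨
    sum a * tupleSum k f + sum (λ x → tupleSum k (g x)) ∎
    where open ≡-Reasoning

  count : ∀ k → (Vec (Fin n) k → Bool) → ℕ
  count k P = tupleSum k (λ t → bool→ℕ (P t))

  bool→ℕ-mono : ∀ {p q} → (p ≡ true → q ≡ true) → bool→ℕ p ≤ bool→ℕ q
  bool→ℕ-mono {false} p⇒q = z≤n
  bool→ℕ-mono {true}  p⇒q rewrite p⇒q refl = s≤s z≤n

  bool→ℕ-split : ∀ p q → bool→ℕ p ≡ bool→ℕ (p ∧ not q) + bool→ℕ (p ∧ q)
  bool→ℕ-split false q     = refl
  bool→ℕ-split true  false = refl
  bool→ℕ-split true  true  = refl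

  count-cong : ∀ k {P Q : Vec (Fin n) k → Bool} → (∀ t → P t ≡ Q t) → count k P ≡ count k Q
  count-cong k P≗Q = tupleSum-cong k (cong bool→ℕ ∘ P≗Q)

  count-mono : ∀ k {P Q : Vec (Fin n) k → Bool} → (∀ t → P t ≡ true → Q t ≡ true) → count k P ≤ count k Q
  count-mono k P⇒Q = tupleSum-mono-≤ k (bool→ℕ-mono ∘ P⇒Q)

  count-split : ∀ k (P Q : Vec (Fin n) k → Bool) →
    count k P ≡ count k (λ t → P t ∧ not (Q t)) + count k (λ t → P t ∧ Q t)
  count-split k P Q =
    trans (tupleSum-cong k λ t → bool→ℕ-split (P t) (Q t)) (tupleSum-distrib-+ k _ _)

  infix 7 _∈ᵇ_

  _∈ᵇ_ : Fin n → Vec (Fin n) k → Bool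
  v ∈ᵇ []       = false
  v ∈ᵇ (x ∷ xs) = does (v ≟ x) ∨ v ∈ᵇ xs

  does-≟-injective : (f : Fin m → Fin n) → Injective _≡_ _≡_ f → ∀ x y → does (f x ≟ f y) ≡ does (x ≟ y)
  does-≟-injective f f-inj x y with x ≟ y
  ... | yes refl = dec-true (f x ≟ f x) refl
  ... | no x≢y   = dec-false (f x ≟ f y) (x≢y ∘ f-inj)

  ∈ᵇ-map : (f : Fin m → Fin n) → Injective _≡_ _≡_ f → ∀ v (t : Vec (Fin m) k) → f v ∈ᵇ map f t ≡ v ∈ᵇ t
  ∈ᵇ-map f f-inj v []       = refl
  ∈ᵇ-map f f-inj v (x ∷ xs) = cong₂ _∨_ (does-≟-injective f f-inj v x) (∈ᵇ-map f f-inj v xs)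

  count-avoid : ∀ k (u : Fin (suc m)) (P : Vec (Fin (suc m)) k → Bool) →
    count k (λ t → P t ∧ not (u ∈ᵇ t)) ≡ count k (λ t → P (map (punchIn u) t))
  count-avoid zero    u P = cong bool→ℕ (∧-identityʳ (P []))
  count-avoid {m} (suc k) u P = begin
    sum (λ x → count k (λ t → P (x ∷ t) ∧ not (u ∈ᵇ (x ∷ t))))
      ≡⟨ sum-remove {i = u} (λ x → count k (λ t → P (x ∷ t) ∧ not (u ∈ᵇ (x ∷ t)))) ⟩
    count k (λ t → P (u ∷ t) ∧ not (u ∈ᵇ (u ∷ t)))
      + sum (λ y → count k (λ t → P (punchIn u y ∷ t) ∧ not (u ∈ᵇ (punchIn u y ∷ t))))
      ≡⟨ cong₂ _+_ at-u (sum-cong-≗ off-u) ⟩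
    0 + sum (λ y → count k (λ t → P (punchIn u y ∷ map (punchIn u) t))) ∎
    where
    open ≡-Reasoning
    at-u : count k (λ t → P (u ∷ t) ∧ not (u ∈ᵇ (u ∷ t))) ≡ 0
    at-u = trans (count-cong k λ t → trans (cong (λ b → P (u ∷ t) ∧ not (b ∨ u ∈ᵇ t)) (dec-true (u ≟ u) refl))
                                           (∧-zeroʳ (P (u ∷ t))))
                 (tupleSum-const k 0)
    off-u : ∀ y → count k (λ t → P (punchIn u y ∷ t) ∧ not (u ∈ᵇ (punchIn u y ∷ t)))
                ≡ count k (λ t → P (punchIn u y ∷ map (punchIn u) t))
    off-u y = trans (count-cong k λ t → cong (λ b → P (punchIn u y ∷ t) ∧ not (b ∨ u ∈ᵇ t))
                                             (dec-false (u ≟ punchIn u y) (punchInᵢ≢i u y ∘ sym)))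
                    (count-avoid k u (λ t → P (punchIn u y ∷ t)))

  ∉ᵇ : ∀ {x} {xs : Vec (Fin n) k} → All (λ y → ¬ x ≡ y) xs → x ∈ᵇ xs ≡ false
  ∉ᵇ []                    = refl
  ∉ᵇ {x = x} (_∷_ {x = y} x≢y x∉xs) rewrite dec-false (x ≟ y) x≢y = ∉ᵇ x∉xs

  sum-∈ᵇ-Unique : (t : Vec (Fin n) k) → Unique t → sum (λ u → bool→ℕ (u ∈ᵇ t)) ≡ k
  sum-∈ᵇ-Unique {n} []       []                 = trans (sum-const n 0) (*-zeroʳ n)
  sum-∈ᵇ-Unique     (x ∷ xs) (x∉xs ∷ xs-unique) = begin
    sum (λ u → bool→ℕ (does (u ≟ x) ∨ u ∈ᵇ xs))              ≡⟨ sum-cong-≗ split ⟩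
    sum (λ u → δ x u + bool→ℕ (u ∈ᵇ xs))                    ≡⟨ ∑-distrib-+ (δ x) (λ u → bool→ℕ (u ∈ᵇ xs)) ⟩
    sum (δ x) + sum (λ u → bool→ℕ (u ∈ᵇ xs))                ≡⟨ cong₂ _+_ (sum-δ x) (sum-∈ᵇ-Unique xs xs-unique) ⟩
    suc _                                                   ∎
    where
    open ≡-Reasoning
    split : ∀ u → bool→ℕ (does (u ≟ x) ∨ u ∈ᵇ xs) ≡ δ x u + bool→ℕ (u ∈ᵇ xs)
    split u with u ≟ x
    ... | yes refl rewrite ∉ᵇ x∉xs = refl
    ... | no _     = refl

  ∈ᵇ-∷-≤ : ∀ (v x : Fin n) (t : Vec (Fin n) k) → bool→ℕ (v ∈ᵇ (x ∷ t)) ≤ δ v x * 1 + bool→ℕ (v ∈ᵇ t)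
  ∈ᵇ-∷-≤ v x t with v ≟ x
  ... | yes refl rewrite dec-true (v ≟ v) refl = s≤s z≤n
  ... | no v≢x   rewrite dec-false (x ≟ v) (v≢x ∘ sym) = ≤-refl

  count-∈ᵇ-∷-≤ : ∀ k (v : Fin n) → count (suc k) (v ∈ᵇ_) ≤ n ^ k + n * count k (v ∈ᵇ_)
  count-∈ᵇ-∷-≤ {n} k v = begin
    count (suc k) (v ∈ᵇ_)
      ≤⟨ sum-mono-≤ (λ x → tupleSum-mono-≤ k (∈ᵇ-∷-≤ v x)) ⟩
    sum (λ x → tupleSum k (λ t → δ v x * 1 + bool→ℕ (v ∈ᵇ t)))
      ≡⟨ tupleSum-linear k (δ v) (λ _ → 1) (λ _ t → bool→ℕ (v ∈ᵇ t)) ⟩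
    sum (δ v) * tupleSum k (λ _ → 1) + sum {n} (λ _ → count k (v ∈ᵇ_))
      ≡⟨ cong₂ (λ a b → a * tupleSum k (λ _ → 1) + b) (sum-δ v) (sum-const n (count k (v ∈ᵇ_))) ⟩
    1 * tupleSum k (λ _ → 1) + n * count k (v ∈ᵇ_)
      ≡⟨ cong (λ a → 1 * a + n * count k (v ∈ᵇ_)) (trans (tupleSum-const k 1) (*-identityˡ (n ^ k))) ⟩
    1 * n ^ k + n * count k (v ∈ᵇ_)
      ≡⟨ cong (_+ n * count k (v ∈ᵇ_)) (*-identityˡ (n ^ k)) ⟩
    n ^ k + n * count k (v ∈ᵇ_) ∎
    where open ≤-Reasoning

  n*count-∈ᵇ-≤ : ∀ k (v : Fin n) → n * count k (v ∈ᵇ_) ≤ k * n ^ k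
  n*count-∈ᵇ-≤ {n} zero    v = ≤-reflexive (*-zeroʳ n)
  n*count-∈ᵇ-≤ {n} (suc k) v = begin
    n * count (suc k) (v ∈ᵇ_)   ≤⟨ *-monoʳ-≤ n (count-∈ᵇ-∷-≤ k v) ⟩
    n * (n ^ k + n * c)         ≡⟨ *-distribˡ-+ n (n ^ k) (n * c) ⟩
    n * n ^ k + n * (n * c)     ≤⟨ +-monoʳ-≤ (n * n ^ k) (*-monoʳ-≤ n (n*count-∈ᵇ-≤ k v)) ⟩
    n * n ^ k + n * (k * n ^ k) ≡⟨ solve 3 (λ n p k → n :* p :+ n :* (k :* p) := (con 1 :+ k) :* (n :* p))
                                           refl n (n ^ k) k ⟩
    suc k * n ^ suc k           ∎
    where
    open ≤-Reasoning
    c = count k (v ∈ᵇ_)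

  ∈ᵇ-∷-pair-≤ : ∀ {v w} → ¬ v ≡ w → ∀ (x : Fin n) (t : Vec (Fin n) k) →
    bool→ℕ (v ∈ᵇ (x ∷ t) ∧ w ∈ᵇ (x ∷ t))
      ≤ δ v x * bool→ℕ (w ∈ᵇ t) + (δ w x * bool→ℕ (v ∈ᵇ t) + bool→ℕ (v ∈ᵇ t ∧ w ∈ᵇ t))
  ∈ᵇ-∷-pair-≤ {v = v} {w} v≢w x t with v ≟ x | w ≟ x
  ... | yes refl | yes refl = contradiction refl v≢w
  ... | yes refl | no w≢v
    rewrite dec-true (v ≟ v) refl | dec-false (v ≟ w) (w≢v ∘ sym) | +-identityʳ (bool→ℕ (w ∈ᵇ t))
    = m≤m+n _ _
  ... | no _     | yes refl
    rewrite dec-false (w ≟ v) (v≢w ∘ sym) | dec-true (w ≟ w) refl | +-identityʳ (bool→ℕ (v ∈ᵇ t))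
          | ∧-identityʳ (v ∈ᵇ t)
    = m≤m+n _ _
  ... | no v≢x   | no w≢x
    rewrite dec-false (x ≟ v) (v≢x ∘ sym) | dec-false (x ≟ w) (w≢x ∘ sym) = ≤-refl

  count-∈ᵇ-pair-∷-≤ : ∀ k {v w : Fin n} → ¬ v ≡ w →
    count (suc k) (λ t → v ∈ᵇ t ∧ w ∈ᵇ t) ≤ count k (w ∈ᵇ_) + (count k (v ∈ᵇ_) + n * count k (λ t → v ∈ᵇ t ∧ w ∈ᵇ t))
  count-∈ᵇ-pair-∷-≤ {n} k {v} {w} v≢w = begin
    count (suc k) (λ t → v ∈ᵇ t ∧ w ∈ᵇ t)
      ≤⟨ sum-mono-≤ (λ x → tupleSum-mono-≤ k (∈ᵇ-∷-pair-≤ v≢w x)) ⟩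
    sum (λ x → tupleSum k (λ t → δ v x * bool→ℕ (w ∈ᵇ t) + (δ w x * bool→ℕ (v ∈ᵇ t) + [both] t)))
      ≡⟨ tupleSum-linear k (δ v) (λ t → bool→ℕ (w ∈ᵇ t)) _ ⟩
    sum (δ v) * count k (w ∈ᵇ_) + sum (λ x → tupleSum k (λ t → δ w x * bool→ℕ (v ∈ᵇ t) + [both] t))
      ≡⟨ cong (sum (δ v) * count k (w ∈ᵇ_) +_) (tupleSum-linear k (δ w) (λ t → bool→ℕ (v ∈ᵇ t)) (λ _ → [both])) ⟩
    sum (δ v) * count k (w ∈ᵇ_) + (sum (δ w) * count k (v ∈ᵇ_) + sum {n} (λ _ → both))
      ≡⟨ cong₂ (λ a b → a * count k (w ∈ᵇ_) + (b * count k (v ∈ᵇ_) + sum {n} (λ _ → both))) (sum-δ v) (sum-δ w) ⟩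
    1 * count k (w ∈ᵇ_) + (1 * count k (v ∈ᵇ_) + sum {n} (λ _ → both))
      ≡⟨ cong₂ (λ a b → a + (b + sum {n} (λ _ → both)))
               (*-identityˡ (count k (w ∈ᵇ_))) (*-identityˡ (count k (v ∈ᵇ_))) ⟩
    count k (w ∈ᵇ_) + (count k (v ∈ᵇ_) + sum {n} (λ _ → both))
      ≡⟨ cong (λ s → count k (w ∈ᵇ_) + (count k (v ∈ᵇ_) + s)) (sum-const n both) ⟩
    count k (w ∈ᵇ_) + (count k (v ∈ᵇ_) + n * both) ∎
    where
    open ≤-Reasoning
    [both] : Vec (Fin n) k → ℕ
    [both] t = bool→ℕ (v ∈ᵇ t ∧ w ∈ᵇ t)
    both = count k (λ t → v ∈ᵇ t ∧ w ∈ᵇ t)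

  n²*count-∈ᵇ-pair-≤ : ∀ k {v w : Fin n} → ¬ v ≡ w → n * n * count k (λ t → v ∈ᵇ t ∧ w ∈ᵇ t) ≤ k * k * n ^ k
  n²*count-∈ᵇ-pair-≤ {n} zero    v≢w = ≤-reflexive (*-zeroʳ (n * n))
  n²*count-∈ᵇ-pair-≤ {n} (suc k) {v} {w} v≢w = begin
    n * n * count (suc k) (λ t → v ∈ᵇ t ∧ w ∈ᵇ t)
      ≤⟨ *-monoʳ-≤ (n * n) (count-∈ᵇ-pair-∷-≤ k v≢w) ⟩
    n * n * (count k (w ∈ᵇ_) + (count k (v ∈ᵇ_) + n * both))
      ≡⟨ solve 4 (λ n a b d → n :* n :* (a :+ (b :+ n :* d)) := n :* (n :* a) :+ n :* (n :* b) :+ n :* (n :* n :* d))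
           refl n (count k (w ∈ᵇ_)) (count k (v ∈ᵇ_)) both ⟩
    n * (n * count k (w ∈ᵇ_)) + n * (n * count k (v ∈ᵇ_)) + n * (n * n * both)
      ≤⟨ +-mono-≤ (+-mono-≤ (*-monoʳ-≤ n (n*count-∈ᵇ-≤ k w)) (*-monoʳ-≤ n (n*count-∈ᵇ-≤ k v)))
                  (*-monoʳ-≤ n (n²*count-∈ᵇ-pair-≤ k v≢w)) ⟩
    n * (k * n ^ k) + n * (k * n ^ k) + n * (k * k * n ^ k)
      ≡⟨ solve 3 (λ n p k → n :* (k :* p) :+ n :* (k :* p) :+ n :* (k :* k :* p) := (k :+ k :+ k :* k) :* (n :* p))
           refl n (n ^ k) k ⟩
    (k + k + k * k) * n ^ suc k
      ≤⟨ *-monoˡ-≤ (n ^ suc k) (n≤1+n (k + k + k * k)) ⟩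
    suc (k + k + k * k) * n ^ suc k
      ≡⟨ cong (_* n ^ suc k) (solve 1 (λ k → con 1 :+ (k :+ k :+ k :* k) := (con 1 :+ k) :* (con 1 :+ k)) refl k) ⟩
    suc k * suc k * n ^ suc k ∎
    where
    open ≤-Reasoning
    both = count k (λ t → v ∈ᵇ t ∧ w ∈ᵇ t)

  count-∈ᵇ-pair-≤ : ∀ i {v w : Fin (suc n)} → ¬ v ≡ w →
    count (2 + i) (λ t → v ∈ᵇ t ∧ w ∈ᵇ t) ≤ (2 + i) * (2 + i) * suc n ^ i
  count-∈ᵇ-pair-≤ {n} i {v} {w} v≢w = *-cancelˡ-≤ (suc n * suc n) (begin
    suc n * suc n * count (2 + i) (λ t → v ∈ᵇ t ∧ w ∈ᵇ t)
      ≤⟨ n²*count-∈ᵇ-pair-≤ (2 + i) v≢w ⟩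
    (2 + i) * (2 + i) * suc n ^ (2 + i)
      ≡⟨ solve 3 (λ K N p → K :* K :* (N :* (N :* p)) := N :* N :* (K :* K :* p)) refl (2 + i) (suc n) (suc n ^ i) ⟩
    suc n * suc n * ((2 + i) * (2 + i) * suc n ^ i) ∎)
    where open ≤-Reasoning

  ∃-minimum : (f : Fin (suc n) → ℕ) → ∃ λ u → ∀ x → f u ≤ f x
  ∃-minimum {zero}  f = zero , λ { zero → ≤-refl }
  ∃-minimum {suc n} f with ∃-minimum (f ∘ suc)
  ... | u , fu≤ with f zero ≤? f (suc u)
  ...   | yes f0≤ = zero  , λ { zero → ≤-refl ; (suc x) → ≤-trans f0≤ (fu≤ x) }
  ...   | no  f0≰ = suc u , λ { zero → <⇒≤ (≰⇒> f0≰) ; (suc x) → fu≤ x }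

  ∃-≤-average : (f : Fin (suc n) → ℕ) → ∃ λ u → suc n * f u ≤ sum f
  ∃-≤-average {n} f with ∃-minimum f
  ... | u , fu≤ = u , subst (_≤ sum f) (sum-const (suc n) (f u)) (sum-mono-≤ fu≤)

module DensityArithmetic where
  open import Data.Nat using (ℕ; zero; suc; _+_; _*_; _^_; _≤_; _<_; z≤n; s≤s; NonZero; >-nonZero)
  open import Data.Nat.Properties
  open import Data.Nat.Combinatorics using (_C_; nCk+nC[k+1]≡[n+1]C[k+1]; nC1≡n)
  open import Data.Nat.Solver using (module +-*-Solver)
  open import Relation.Binary.PropositionalEquality
  open +-*-Solver

  [n+1]*nCk≡[k+1]*[n+1]C[k+1] : ∀ n k → suc n * (n C k) ≡ suc k * (suc n C suc k)
  [n+1]*nCk≡[k+1]*[n+1]C[k+1] zero    zero    = refl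
  [n+1]*nCk≡[k+1]*[n+1]C[k+1] zero    (suc k) = sym (*-zeroʳ (suc (suc k)))
  [n+1]*nCk≡[k+1]*[n+1]C[k+1] (suc n) zero    =
    trans (*-identityʳ (suc (suc n))) (sym (trans (+-identityʳ _) (nC1≡n (suc (suc n)))))
  [n+1]*nCk≡[k+1]*[n+1]C[k+1] (suc n) (suc k) = begin
    suc (suc n) * (suc n C suc k)
      ≡⟨ cong (suc (suc n) *_) (pascal n k) ⟨
    suc (suc n) * (x + y)
      ≡⟨ solve 3 (λ n x y → (con 2 :+ n) :* (x :+ y) := (con 1 :+ n) :* x :+ (con 1 :+ n) :* y :+ (x :+ y))
                 refl n x y ⟩
    suc n * x + suc n * y + (x + y)
      ≡⟨ cong₂ (λ a b → a + b + (x + y))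
               (trans ([n+1]*nCk≡[k+1]*[n+1]C[k+1] n k) (cong (suc k *_) (sym (pascal n k))))
               ([n+1]*nCk≡[k+1]*[n+1]C[k+1] n (suc k)) ⟩
    suc k * (x + y) + suc (suc k) * z + (x + y)
      ≡⟨ solve 3 (λ k s z → (con 1 :+ k) :* s :+ (con 2 :+ k) :* z :+ s := (con 2 :+ k) :* (s :+ z)) refl k (x + y) z ⟩
    suc (suc k) * ((x + y) + z)
      ≡⟨ cong (λ s → suc (suc k) * (s + z)) (pascal n k) ⟩
    suc (suc k) * (suc n C suc k + suc n C suc (suc k))
      ≡⟨ cong (suc (suc k) *_) (pascal (suc n) (suc k)) ⟩
    suc (suc k) * (suc (suc n) C suc (suc k)) ∎
    where
    open ≡-Reasoning
    pascal = nCk+nC[k+1]≡[n+1]C[k+1]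
    x = n C k
    y = n C suc k
    z = suc n C suc (suc k)

  0<nCk : ∀ {n k} → k ≤ n → 0 < n C k
  0<nCk {n}     {zero}  _         = s≤s z≤n
  0<nCk {suc n} {suc k} (s≤s k≤n) =
    subst (0 <_) (nCk+nC[k+1]≡[n+1]C[k+1] n k) (<-≤-trans (0<nCk k≤n) (m≤m+n _ _))

  -- Used with N = m+1, K = j+1, c = C(m,j+1), b = C(m,j), c′ = C(m+1,j+1): deleting a vertex whose
  -- degree A is at most the average K T / N does not lower the density T / C(·,j+1).
  density-≤-deletion : ∀ {N K T T′ A c b c′} .{{_ : NonZero N}} →
    T ≡ T′ + A → N * A ≤ K * T → c′ ≡ c + b → N * b ≡ K * c′ → T * c ≤ T′ * c′
  density-≤-deletion {N} {K} {T} {T′} {A} {c} {b} {c′} T≡ NA≤KT c′≡ Nb≡Kc′ =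
    *-cancelˡ-≤ N (+-cancelʳ-≤ (N * (A * c′)) _ _ (begin
      N * (T * c) + N * (A * c′)
        ≡⟨ cong₂ _+_ (*-assoc N T c) (*-assoc N A c′) ⟨
      N * T * c + N * A * c′
        ≤⟨ +-monoʳ-≤ (N * T * c) (*-monoˡ-≤ c′ NA≤KT) ⟩
      N * T * c + K * T * c′
        ≡⟨ cong (N * T * c +_) (solve 3 (λ K T c′ → K :* T :* c′ := T :* (K :* c′)) refl K T c′) ⟩
      N * T * c + T * (K * c′)
        ≡⟨ cong (λ z → N * T * c + T * z) (sym Nb≡Kc′) ⟩
      N * T * c + T * (N * b)
        ≡⟨ solve 4 (λ N T c b → N :* T :* c :+ T :* (N :* b) := N :* T :* (c :+ b)) refl N T c b ⟩
      N * T * (c + b)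
        ≡⟨ cong (N * T *_) (sym c′≡) ⟩
      N * T * c′
        ≡⟨ cong (λ z → N * z * c′) T≡ ⟩
      N * (T′ + A) * c′
        ≡⟨ solve 4 (λ N T′ A c′ → N :* (T′ :+ A) :* c′ := N :* (T′ :* c′) :+ N :* (A :* c′)) refl N T′ A c′ ⟩
      N * (T′ * c′) + N * (A * c′) ∎))
    where open ≤-Reasoning

  *-≤-ratio-trans : ∀ {X Y T p q r} → 0 < q → X * p ≤ Y * q → T * q ≤ X * r → T * p ≤ Y * r
  *-≤-ratio-trans {X} {Y} {T} {p} {q} {r} 0<q Xp≤Yq Tq≤Xr = *-cancelˡ-≤ q {{>-nonZero 0<q}} (begin
    q * (T * p) ≡⟨ solve 3 (λ q T p → q :* (T :* p) := T :* q :* p) refl q T p ⟩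
    T * q * p   ≤⟨ *-monoˡ-≤ p Tq≤Xr ⟩
    X * r * p   ≡⟨ solve 3 (λ X r p → X :* r :* p := X :* p :* r) refl X r p ⟩
    X * p * r   ≤⟨ *-monoˡ-≤ r Xp≤Yq ⟩
    Y * q * r   ≡⟨ solve 3 (λ Y q r → Y :* q :* r := q :* (Y :* r)) refl Y q r ⟩
    q * (Y * r) ∎)
    where open ≤-Reasoning

  density-≤-degree : ∀ {N K T T′ D c c′ b} .{{_ : NonZero N}} →
    N * b ≡ K * c → T * c ≤ T′ * c′ → K * T′ ≤ N * D → T * b ≤ D * c′
  density-≤-degree {N} {K} {T} {T′} {D} {c} {c′} {b} Nb≡Kc Tc≤T′c′ KT′≤ND = *-cancelˡ-≤ N (begin
    N * (T * b)   ≡⟨ solve 3 (λ N T b → N :* (T :* b) := T :* (N :* b)) refl N T b ⟩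
    T * (N * b)   ≡⟨ cong (T *_) Nb≡Kc ⟩
    T * (K * c)   ≡⟨ solve 3 (λ T K c → T :* (K :* c) := K :* (T :* c)) refl T K c ⟩
    K * (T * c)   ≤⟨ *-monoʳ-≤ K Tc≤T′c′ ⟩
    K * (T′ * c′) ≡⟨ *-assoc K T′ c′ ⟨
    K * T′ * c′   ≤⟨ *-monoˡ-≤ c′ KT′≤ND ⟩
    N * D * c′    ≡⟨ *-assoc N D c′ ⟩
    N * (D * c′)  ∎)
    where open ≤-Reasoning

  a*b≤n⇒a*n²*b≤n³ : ∀ {a b n} → a * b ≤ n → a * n ^ 2 * b ≤ n ^ 3
  a*b≤n⇒a*n²*b≤n³ {a} {b} {n} ab≤n = begin
    a * n ^ 2 * b   ≡⟨ solve 3 (λ a b n → a :* (n :^ 2) :* b := (a :* b) :* (n :^ 2)) refl a b n ⟩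
    a * b * n ^ 2   ≤⟨ *-monoˡ-≤ (n ^ 2) ab≤n ⟩
    n * n ^ 2       ∎
    where open ≤-Reasoning

module PatternCounting where
  open import Data.Bool using (Bool; true; false; _∧_; if_then_else_)
  open import Data.Fin using (Fin; suc; punchIn; punchOut; _≟_)
  open import Data.Fin.Properties using (punchIn-injective; punchInᵢ≢i; punchIn-punchOut)
  open import Data.Fin.Permutation using (transpose; _⟨$⟩ʳ_; _⟨$⟩ˡ_; inverseˡ)
  open import Data.Nat using (ℕ; zero; suc; _+_; _*_; _^_; _≤_)
  open import Data.Nat.Properties hiding (_≟_)
  open import Data.Product using (∃; _×_; _,_)
  open import Data.Vec using (Vec; map)
  open import Data.Vec.Properties using (map-id)
  open import Data.Vec.Relation.Unary.Unique.Propositional using (Unique)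
  open import Function using (_∘_; id)
  open import Function.Definitions using (Injective)
  open import Relation.Binary.PropositionalEquality
  open import Relation.Nullary using (does; yes; no; ¬_)
  open import Relation.Nullary.Decidable using (dec-true; dec-false)
  open import Data.Nat.Combinatorics using (_C_; nCk+nC[k+1]≡[n+1]C[k+1])
  open import Algebra.Properties.Semiring.Sum +-*-semiring using (sum; sum-cong-≗)
  open import Defs using (Graph; adj; KFree; bool→ℕ)
  open TupleCounting
  open DensityArithmetic

  private
    variable
      m n : ℕ

  comap : (Fin m → Fin n) → Graph n → Graph m
  comap f G = record
    { adj    = λ x y → adj G (f x) (f y)
    ; sym    = λ x y → Graph.sym G (f x) (f y)
    ; irrefl = λ x → Graph.irrefl G (f x)
    }

  deleteVertex : Graph (suc n) → Fin (suc n) → Graph n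
  deleteVertex G u = comap (punchIn u) G

  redirect : Fin n → Fin n → Fin n → Fin n
  redirect v w x = if does (x ≟ v) then w else x

  -- v is replaced by a copy of w: the two become non-adjacent twins.
  clone : Graph n → Fin n → Fin n → Graph n
  clone G v w = comap (redirect v w) G

  KFree-comap : ∀ r (f : Fin m → Fin n) (G : Graph n) → KFree r G → KFree r (comap f G)
  KFree-comap r f G G-free (g , g-inj , g-clique) = G-free (f ∘ g , fg-inj , g-clique)
    where
    -- distinct clique vertices are adjacent, so irreflexivity forbids f from identifying them
    fg-inj : Injective _≡_ _≡_ (f ∘ g)
    fg-inj {i} {j} fgi≡fgj with i ≟ j
    ... | yes i≡j = i≡j
    ... | no  i≢j with () ← trans (sym (g-clique i j i≢j))
                                 (trans (cong (λ z → adj G z (f (g j))) fgi≡fgj) (Graph.irrefl G (f (g j))))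

  transpose-injective : (v w : Fin n) → Injective _≡_ _≡_ (transpose v w ⟨$⟩ʳ_)
  transpose-injective v w eq = trans (sym (inverseˡ π)) (trans (cong (π ⟨$⟩ˡ_) eq) (inverseˡ π))
    where π = transpose v w

  transpose-matchʳ : (v w : Fin n) → transpose v w ⟨$⟩ʳ w ≡ v
  transpose-matchʳ v w with w ≟ v
  ... | yes w≡v = w≡v
  ... | no  _   rewrite dec-true (w ≟ w) refl = refl

  redirect-transpose : (v w x : Fin n) → redirect v w (transpose v w ⟨$⟩ʳ x) ≡ redirect v w x
  redirect-transpose v w x with x ≟ v
  ... | yes refl with does (w ≟ x)
  ...   | true  = refl
  ...   | false = refl
  redirect-transpose v w x | no x≢v with x ≟ w
  ...   | yes refl rewrite dec-true (v ≟ v) refl = refl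
  ...   | no x≢w rewrite dec-false (x ≟ v) x≢v = refl

  redirect-punchIn : (v w : Fin (suc n)) (x : Fin n) → redirect v w (punchIn v x) ≡ punchIn v x
  redirect-punchIn v w x rewrite dec-false (punchIn v x ≟ v) (punchInᵢ≢i v x) = refl

  record Pattern (k : ℕ) : Set₁ where
    field
      isCopy         : Graph n → Vec (Fin n) k → Bool
      isCopy⇒Unique  : (G : Graph n) (t : Vec (Fin n) k) → isCopy G t ≡ true → Unique t
      isCopy-relabel : (f : Fin m → Fin n) → Injective _≡_ _≡_ f → (G : Graph n) (H : Graph m) →
                       (∀ x y → adj G (f x) (f y) ≡ adj H x y) →
                       ∀ t → isCopy G (map f t) ≡ isCopy H t

  module _ {k : ℕ} (P : Pattern k) where
    open Pattern P

    copies : Graph n → ℕ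
    copies G = count k (isCopy G)

    copiesAt : Graph n → Fin n → ℕ
    copiesAt G v = count k (λ t → isCopy G t ∧ v ∈ᵇ t)

    isCopy-cong : (G H : Graph n) → (∀ x y → adj G x y ≡ adj H x y) → ∀ t → isCopy G t ≡ isCopy H t
    isCopy-cong G H G≗H t = trans (cong (isCopy G) (sym (map-id t))) (isCopy-relabel id id G H G≗H t)

    isCopy-deleteVertex : (G : Graph (suc n)) (u : Fin (suc n)) →
      ∀ t → isCopy G (map (punchIn u) t) ≡ isCopy (deleteVertex G u) t
    isCopy-deleteVertex G u = isCopy-relabel (punchIn u) (punchIn-injective u _ _) G (deleteVertex G u) (λ _ _ → refl)

    copies-deleteVertex : (G : Graph (suc n)) (u : Fin (suc n)) →
      copies G ≡ copies (deleteVertex G u) + copiesAt G u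
    copies-deleteVertex G u = trans (count-split k (isCopy G) (u ∈ᵇ_))
      (cong (_+ copiesAt G u) (trans (count-avoid k u (isCopy G)) (count-cong k (isCopy-deleteVertex G u))))

    copiesAt-deleteVertex : (G : Graph (suc n)) (v : Fin (suc n)) (w : Fin n) →
      copiesAt G (punchIn v w)
        ≡ copiesAt (deleteVertex G v) w + count k (λ t → (isCopy G t ∧ punchIn v w ∈ᵇ t) ∧ v ∈ᵇ t)
    copiesAt-deleteVertex {n} G v w = trans (count-split k through-w (v ∈ᵇ_))
      (cong (_+ count k (λ t → through-w t ∧ v ∈ᵇ t))
            (trans (count-avoid k v through-w)
                   (count-cong k λ t → cong₂ _∧_ (isCopy-deleteVertex G v t)
                                                 (∈ᵇ-map (punchIn v) (punchIn-injective v _ _) w t))))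
      where
      through-w : Vec (Fin (suc n)) k → Bool
      through-w t = isCopy G t ∧ punchIn v w ∈ᵇ t

    sum-copiesAt : (G : Graph n) → sum (copiesAt G) ≡ k * copies G
    sum-copiesAt {n} G = begin
      sum (λ u → count k (λ t → isCopy G t ∧ u ∈ᵇ t))
        ≡⟨ tupleSum-comm k (λ u t → bool→ℕ (isCopy G t ∧ u ∈ᵇ t)) ⟩
      tupleSum k (λ t → sum (λ u → bool→ℕ (isCopy G t ∧ u ∈ᵇ t)))
        ≡⟨ tupleSum-cong k per-tuple ⟩
      tupleSum k (λ t → k * bool→ℕ (isCopy G t))
        ≡⟨ *-distribˡ-tupleSum k k (λ t → bool→ℕ (isCopy G t)) ⟨
      k * copies G ∎
      where
      open ≡-Reasoning
      per-tuple : ∀ t → sum (λ u → bool→ℕ (isCopy G t ∧ u ∈ᵇ t)) ≡ k * bool→ℕ (isCopy G t)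
      per-tuple t with isCopy G t in copy
      ... | false = trans (sum-const n 0) (trans (*-zeroʳ n) (sym (*-zeroʳ k)))
      ... | true  = trans (sum-∈ᵇ-Unique t (isCopy⇒Unique G t copy)) (sym (*-identityʳ k))

    copiesAt-cong : (G H : Graph n) → (∀ x y → adj G x y ≡ adj H x y) → ∀ v → copiesAt G v ≡ copiesAt H v
    copiesAt-cong G H G≗H v = count-cong k λ t → cong (_∧ v ∈ᵇ t) (isCopy-cong G H G≗H t)

    copies-cong : (G H : Graph n) → (∀ x y → adj G x y ≡ adj H x y) → copies G ≡ copies H
    copies-cong G H G≗H = count-cong k (isCopy-cong G H G≗H)

    copiesAt-clone-twins : (G : Graph n) (v w : Fin n) → copiesAt (clone G v w) v ≡ copiesAt (clone G v w) w
    copiesAt-clone-twins G v w = begin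
      count k (λ t → isCopy G′ t ∧ v ∈ᵇ t)
        ≡⟨ tupleSum-permute k (transpose v w) (λ t → bool→ℕ (isCopy G′ t ∧ v ∈ᵇ t)) ⟩
      count k (λ t → isCopy G′ (map τ t) ∧ v ∈ᵇ map τ t)
        ≡⟨ count-cong k (λ t → cong₂ _∧_ (isCopy-relabel τ τ-inj G′ G′ twins t) (∈ᵇ-τ t)) ⟩
      count k (λ t → isCopy G′ t ∧ w ∈ᵇ t) ∎
      where
      open ≡-Reasoning
      G′ = clone G v w
      τ = transpose v w ⟨$⟩ʳ_
      τ-inj = transpose-injective v w
      twins : ∀ x y → adj G′ (τ x) (τ y) ≡ adj G′ x y
      twins x y = cong₂ (adj G) (redirect-transpose v w x) (redirect-transpose v w y)
      ∈ᵇ-τ : ∀ t → v ∈ᵇ map τ t ≡ w ∈ᵇ t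
      ∈ᵇ-τ t = trans (cong (λ z → z ∈ᵇ map τ t) (sym (transpose-matchʳ v w))) (∈ᵇ-map τ τ-inj w t)

    copiesAt-≤-clone : (G : Graph (suc n)) (v w : Fin (suc n)) → ¬ v ≡ w → copies (clone G v w) ≤ copies G →
      copiesAt G w ≤ copiesAt G v + count k (λ t → w ∈ᵇ t ∧ v ∈ᵇ t)
    copiesAt-≤-clone G v w v≢w clone≤G =
      subst (λ z → copiesAt G z ≤ copiesAt G v + count k (λ t → z ∈ᵇ t ∧ v ∈ᵇ t)) (punchIn-punchOut v≢w) (begin
        copiesAt G (punchIn v w′)
          ≡⟨ copiesAt-deleteVertex G v w′ ⟩
        copiesAt (deleteVertex G v) w′ + count k (λ t → (isCopy G t ∧ punchIn v w′ ∈ᵇ t) ∧ v ∈ᵇ t)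
          ≤⟨ +-mono-≤ (≤-reflexive (copiesAt-cong _ _ deletions-agree w′))
                      (count-mono k λ t → through-both (isCopy G t)) ⟩
        copiesAt (deleteVertex G′ v) w′ + D
          ≤⟨ +-monoˡ-≤ D (m≤m+n _ _) ⟩
        copiesAt (deleteVertex G′ v) w′ + count k (λ t → (isCopy G′ t ∧ punchIn v w′ ∈ᵇ t) ∧ v ∈ᵇ t) + D
          ≡⟨ cong (_+ D) (copiesAt-deleteVertex G′ v w′) ⟨
        copiesAt G′ (punchIn v w′) + D
          ≡⟨ cong (λ z → copiesAt G′ z + D) (punchIn-punchOut v≢w) ⟩
        copiesAt G′ w + D
          ≡⟨ cong (_+ D) (copiesAt-clone-twins G v w) ⟨
        copiesAt G′ v + D
          ≤⟨ +-monoˡ-≤ D clone-at-v ⟩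
        copiesAt G v + D ∎)
      where
      open ≤-Reasoning
      G′ = clone G v w
      w′ = punchOut v≢w
      D = count k (λ t → punchIn v w′ ∈ᵇ t ∧ v ∈ᵇ t)
      deletions-agree : ∀ x y → adj (deleteVertex G v) x y ≡ adj (deleteVertex G′ v) x y
      deletions-agree x y = sym (cong₂ (adj G) (redirect-punchIn v w x) (redirect-punchIn v w y))
      through-both : ∀ c {a b} → (c ∧ a) ∧ b ≡ true → a ∧ b ≡ true
      through-both true eq = eq
      clone-at-v : copiesAt G′ v ≤ copiesAt G v
      clone-at-v = +-cancelˡ-≤ (copies (deleteVertex G v)) _ _ (begin
        copies (deleteVertex G v) + copiesAt G′ v  ≡⟨ cong (_+ copiesAt G′ v) (copies-cong _ _ deletions-agree) ⟩
        copies (deleteVertex G′ v) + copiesAt G′ v ≡⟨ copies-deleteVertex G′ v ⟨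
        copies G′                                  ≤⟨ clone≤G ⟩
        copies G                                   ≡⟨ copies-deleteVertex G v ⟩
        copies (deleteVertex G v) + copiesAt G v   ∎)

  Hereditary : (∀ {n} → Graph n → Set) → Set
  Hereditary Q = ∀ {m} (H : Graph (suc m)) (u : Fin (suc m)) → Q H → Q (deleteVertex H u)

  module _ {j : ℕ} (P : Pattern (suc j)) where

    copies-density-deleteVertex : (H : Graph (suc m)) →
      ∃ λ u → copies P H * (m C suc j) ≤ copies P (deleteVertex H u) * (suc m C suc j)
    copies-density-deleteVertex {m} H =
      let u , below-average = ∃-≤-average (copiesAt P H) in
      u , density-≤-deletion {N = suc m} {K = suc j} {copies P H} {copies P (deleteVertex H u)} {copiesAt P H u}
            (copies-deleteVertex P H u)
            (subst (suc m * copiesAt P H u ≤_) (sum-copiesAt P H) below-average)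
            (trans (sym (nCk+nC[k+1]≡[n+1]C[k+1] m j)) (+-comm (m C j) (m C suc j)))
            ([n+1]*nCk≡[k+1]*[n+1]C[k+1] m j)

    copies-density-shrink : (Q : ∀ {n} → Graph n → Set) → Hereditary Q → suc j ≤ n →
      ∀ d (H : Graph (d + n)) → Q H →
      ∃ λ (H′ : Graph n) → Q H′ × copies P H * (n C suc j) ≤ copies P H′ * ((d + n) C suc j)
    copies-density-shrink Q Q-hered j<n zero    H QH = H , QH , ≤-refl
    copies-density-shrink Q Q-hered j<n (suc d) H QH =
      let u , step = copies-density-deleteVertex H
          H′ , QH′ , rest = copies-density-shrink Q Q-hered j<n d (deleteVertex H u) (Q-hered H u QH)
      in H′ , QH′ , *-≤-ratio-trans {X = copies P (deleteVertex H u)} {copies P H′} {copies P H}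
                                    (0<nCk (≤-trans j<n (m≤n+m _ d))) rest step

  module _ {i : ℕ} (P : Pattern (2 + i)) where

    private
      k = 2 + i

    clone-maximal⇒copies-≤-copiesAt : (G : Graph (suc n)) → (∀ v w → copies P (clone G v w) ≤ copies P G) →
      ∀ v → k * copies P G ≤ suc n * (copiesAt P G v + k * k * suc n ^ i)
    clone-maximal⇒copies-≤-copiesAt {n} G clone-maximal v =
      subst₂ _≤_ (sum-copiesAt P G) (sum-const (suc n) _) (sum-mono-≤ degree-bound)
      where
      degree-bound : ∀ w → copiesAt P G w ≤ copiesAt P G v + k * k * suc n ^ i
      degree-bound w with v ≟ w
      ... | yes refl = m≤m+n _ _
      ... | no v≢w   = ≤-trans (copiesAt-≤-clone P G v w v≢w (clone-maximal v w))
                               (+-monoʳ-≤ (copiesAt P G v) (count-∈ᵇ-pair-≤ i (v≢w ∘ sym)))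

module PathPattern where
  open import Data.Bool using (Bool; true; false; _∧_; _∨_; if_then_else_)
  open import Data.Bool.Properties using (∨-identityʳ)
  open import Data.Fin using (Fin; zero; suc; _≟_)
  open import Data.List using (map; tabulate)
  import Data.Nat.ListAction as List
  open import Data.Nat using (ℕ; zero; suc; _+_)
  open import Data.Product using (_×_; _,_)
  open import Data.Vec using (Vec; []; _∷_)
  open import Data.Vec.Relation.Unary.All using ([]; _∷_)
  open import Data.Vec.Relation.Unary.AllPairs using ([]; _∷_)
  open import Data.Vec.Relation.Unary.Unique.Propositional using (Unique)
  open import Function using (_∘_; id)
  open import Function.Definitions using (Injective)
  open import Relation.Binary.PropositionalEquality
  open import Relation.Nullary using (does; yes; no; ¬_)
  open import Data.Nat.Properties using (+-*-semiring)
  open import Algebra.Properties.Semiring.Sum +-*-semiring using (sum; sum-cong-≗)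
  open import Defs hiding (sym)
  open TupleCounting
  open PatternCounting

  uncurry⁴ : ∀ {n} → (Fin n → Fin n → Fin n → Fin n → Bool) → Vec (Fin n) 4 → Bool
  uncurry⁴ P (a ∷ b ∷ c ∷ d ∷ []) = P a b c d

  isPathᵛ : ∀ {n} → Graph n → Vec (Fin n) 4 → Bool
  isPathᵛ G = uncurry⁴ (isPath G)

  ≢ᵇ-∧ : ∀ {n} {x y : Fin n} {p} → (x ≢ᵇ y) ∧ p ≡ true → ¬ x ≡ y × p ≡ true
  ≢ᵇ-∧ {x = x} {y} eq with x ≟ y
  ≢ᵇ-∧ () | yes _
  ... | no x≢y = x≢y , eq

  isPath⇒Unique : ∀ {n} (G : Graph n) t → isPathᵛ G t ≡ true → Unique t
  isPath⇒Unique G (a ∷ b ∷ c ∷ d ∷ []) path =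
    let a≢b , e₁ = ≢ᵇ-∧ path
        a≢c , e₂ = ≢ᵇ-∧ e₁
        a≢d , e₃ = ≢ᵇ-∧ e₂
        b≢c , e₄ = ≢ᵇ-∧ e₃
        b≢d , e₅ = ≢ᵇ-∧ e₄
        c≢d , _  = ≢ᵇ-∧ e₅
    in (a≢b ∷ a≢c ∷ a≢d ∷ []) ∷ (b≢c ∷ b≢d ∷ []) ∷ (c≢d ∷ []) ∷ [] ∷ []

  isPath-relabel : ∀ {m n} (f : Fin m → Fin n) → Injective _≡_ _≡_ f → (G : Graph n) (H : Graph m) →
    (∀ x y → adj G (f x) (f y) ≡ adj H x y) → ∀ t → isPathᵛ G (Data.Vec.map f t) ≡ isPathᵛ H t
  isPath-relabel f f-inj G H f-embeds (a ∷ b ∷ c ∷ d ∷ []) =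
    cong₂ _∧_ (≢ᵇ a b) (cong₂ _∧_ (≢ᵇ a c) (cong₂ _∧_ (≢ᵇ a d) (cong₂ _∧_ (≢ᵇ b c) (cong₂ _∧_ (≢ᵇ b d)
      (cong₂ _∧_ (≢ᵇ c d) (cong₂ _∧_ (f-embeds a b) (cong₂ _∧_ (f-embeds b c) (f-embeds c d))))))))
    where
    ≢ᵇ : ∀ x y → (f x ≢ᵇ f y) ≡ (x ≢ᵇ y)
    ≢ᵇ x y = cong (if_then false else true) (does-≟-injective f f-inj x y)

  P₃ : Pattern 4
  P₃ = record
    { isCopy         = isPathᵛ
    ; isCopy⇒Unique  = isPath⇒Unique
    ; isCopy-relabel = isPath-relabel
    }

  ΣFin≡sum : ∀ n (f : Fin n → ℕ) → ΣFin n f ≡ sum f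
  ΣFin≡sum n f = sum-tabulate n id
    where
    sum-tabulate : ∀ m (g : Fin m → Fin n) → List.sum (map f (tabulate g)) ≡ sum (f ∘ g)
    sum-tabulate zero    g = refl
    sum-tabulate (suc m) g = cong (f (g zero) +_) (sum-tabulate m (g ∘ suc))

  ΣFin⁴≡count : ∀ n (P : Fin n → Fin n → Fin n → Fin n → Bool) →
    (ΣFin n λ a → ΣFin n λ b → ΣFin n λ c → ΣFin n λ d → bool→ℕ (P a b c d))
      ≡ count 4 (uncurry⁴ P)
  ΣFin⁴≡count n P =
    trans (ΣFin≡sum n λ a → ΣFin n λ b → ΣFin n λ c → ΣFin n (f a b c)) (sum-cong-≗ {n} λ a →
    trans (ΣFin≡sum n λ b → ΣFin n λ c → ΣFin n (f a b c))             (sum-cong-≗ {n} λ b →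
    trans (ΣFin≡sum n λ c → ΣFin n (f a b c))                          (sum-cong-≗ {n} λ c →
    ΣFin≡sum n (f a b c))))
    where
    f : Fin n → Fin n → Fin n → Fin n → ℕ
    f a b c d = bool→ℕ (P a b c d)

  orderedP3≡copies : ∀ {n} (G : Graph n) → orderedP3 G ≡ copies P₃ G
  orderedP3≡copies {n} G = ΣFin⁴≡count n (isPath G)

  orderedP3at≡copiesAt : ∀ {n} (G : Graph n) (v : Fin n) → orderedP3at G v ≡ copiesAt P₃ G v
  orderedP3at≡copiesAt {n} G v = trans (ΣFin⁴≡count n _)
    (count-cong 4 {P = uncurry⁴ _} {Q = λ t → isPathᵛ G t ∧ v ∈ᵇ t} λ { (a ∷ b ∷ c ∷ d ∷ []) →
      cong (isPath G a b c d ∧_) (if-chain≡∨ (does (v ≟ a)) (does (v ≟ b)) (does (v ≟ c)) (does (v ≟ d))) })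
    where
    if-chain≡∨ : ∀ p q r s →
      (if p then true else if q then true else if r then true else s) ≡ p ∨ (q ∨ (r ∨ (s ∨ false)))
    if-chain≡∨ true  q     r     s = refl
    if-chain≡∨ false true  r     s = refl
    if-chain≡∨ false false true  s = refl
    if-chain≡∨ false false false s = sym (∨-identityʳ s)

module RationalBounds where
  open import Data.Integer using (+_; +≤+)
  import Data.Integer as ℤ
  import Data.Integer.Properties as ℤ
  open import Data.Nat as ℕ using (ℕ; suc)
  import Data.Nat.Properties as ℕ
  open import Data.Nat.Coprimality using (Coprime; 1-coprimeTo) renaming (sym to coprime-sym)
  open import Data.Rational using (ℚ; mkℚ; _/_; 0ℚ; 1ℚ; _+_; _*_; _-_; -_; NonNegative; Positive; *≤*)
    renaming (_≤_ to _≤ℚ_)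
  open import Data.Rational.Properties
  open import Data.Rational.Solver using (module +-*-Solver)
  open import Relation.Binary.PropositionalEquality
  open import Defs using (toℚ; recip)
  open +-*-Solver

  private
    coprime-1 : ∀ m → Coprime m 1
    coprime-1 m = coprime-sym (1-coprimeTo m)

    toℚ≡mkℚ : ∀ m → toℚ m ≡ mkℚ (+ m) 0 (coprime-1 m)
    toℚ≡mkℚ m = normalize-coprime (coprime-1 m)

  toℚ-+ : ∀ a b → toℚ (a ℕ.+ b) ≡ toℚ a + toℚ b
  toℚ-+ a b rewrite toℚ≡mkℚ a | toℚ≡mkℚ b =
    cong (_/ 1) (sym (trans (cong₂ ℤ._+_ (ℤ.*-identityʳ (+ a)) (ℤ.*-identityʳ (+ b))) (sym (ℤ.pos-+ a b))))

  toℚ-* : ∀ a b → toℚ (a ℕ.* b) ≡ toℚ a * toℚ b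
  toℚ-* a b rewrite toℚ≡mkℚ a | toℚ≡mkℚ b = cong (_/ 1) (sym (ℤ.+◃n≡+n (a ℕ.* b)))

  toℚ-mono-≤ : ∀ {a b} → a ℕ.≤ b → toℚ a ≤ℚ toℚ b
  toℚ-mono-≤ {a} {b} a≤b rewrite toℚ≡mkℚ a | toℚ≡mkℚ b =
    *≤* (subst₂ ℤ._≤_ (sym (ℤ.*-identityʳ (+ a))) (sym (ℤ.*-identityʳ (+ b))) (+≤+ a≤b))

  toℚ-cancel-≤ : ∀ {a b} → toℚ a ≤ℚ toℚ b → a ℕ.≤ b
  toℚ-cancel-≤ {a} {b} a≤b rewrite toℚ≡mkℚ a | toℚ≡mkℚ b with a≤b
  ... | *≤* a≤b′ = ℤ.drop‿+≤+ (subst₂ ℤ._≤_ (ℤ.*-identityʳ (+ a)) (ℤ.*-identityʳ (+ b)) a≤b′)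

  toℚ-nonNeg : ∀ a → NonNegative (toℚ a)
  toℚ-nonNeg a rewrite toℚ≡mkℚ a = _

  toℚ-pos : ∀ a → 0 ℕ.< a → Positive (toℚ a)
  toℚ-pos (suc a) _ rewrite toℚ≡mkℚ (suc a) = _

  recip-nonNeg : ∀ a → NonNegative (recip a)
  recip-nonNeg ℕ.zero    = _
  recip-nonNeg (suc a) = normalize-nonNeg 1 (suc a)

  recip-inverse : ∀ a → recip (suc a) * toℚ (suc a) ≡ 1ℚ
  recip-inverse a rewrite toℚ≡mkℚ (suc a) | normalize-coprime {1} {a} (1-coprimeTo (suc a)) =
    *-inverseˡ (mkℚ (+ suc a) 0 (coprime-1 (suc a)))

  toℚ-≤-recip-* : ∀ {a b m} → 0 ℕ.< m → a ℕ.* m ℕ.≤ b → toℚ a ≤ℚ recip m * toℚ b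
  toℚ-≤-recip-* {a} {b} {suc k} 0<m am≤b = *-cancelʳ-≤-pos (toℚ (suc k)) {{toℚ-pos (suc k) 0<m}} (begin
    toℚ a * toℚ (suc k)                   ≡⟨ toℚ-* a (suc k) ⟨
    toℚ (a ℕ.* suc k)                     ≤⟨ toℚ-mono-≤ am≤b ⟩
    toℚ b                                 ≡⟨ *-identityʳ (toℚ b) ⟨
    toℚ b * 1ℚ                            ≡⟨ cong (toℚ b *_) (recip-inverse k) ⟨
    toℚ b * (recip (suc k) * toℚ (suc k)) ≡⟨ solve 3 (λ b r K → b :* (r :* K) := (r :* b) :* K)
                                                     refl (toℚ b) (recip (suc k)) (toℚ (suc k)) ⟩
    recip (suc k) * toℚ b * toℚ (suc k)   ∎)
    where open ≤-Reasoning

  *-≤-transfer : ∀ (x y : ℚ) {a b c d} → .{{NonNegative y}} → 0 ℕ.< a → x * toℚ a ≤ℚ toℚ b * y →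
    b ℕ.* c ℕ.≤ d ℕ.* a → x * toℚ c ≤ℚ toℚ d * y
  *-≤-transfer x y {a} {b} {c} {d} 0<a xa≤by bc≤da = *-cancelʳ-≤-pos (toℚ a) {{toℚ-pos a 0<a}} (begin
    x * toℚ c * toℚ a             ≡⟨ solve 3 (λ x c a → x :* c :* a := x :* a :* c) refl x (toℚ c) (toℚ a) ⟩
    x * toℚ a * toℚ c             ≤⟨ *-monoʳ-≤-nonNeg (toℚ c) {{toℚ-nonNeg c}} xa≤by ⟩
    toℚ b * y * toℚ c             ≡⟨ solve 3 (λ b y c → b :* y :* c := b :* c :* y) refl (toℚ b) y (toℚ c) ⟩
    toℚ b * toℚ c * y             ≡⟨ cong (_* y) (toℚ-* b c) ⟨
    toℚ (b ℕ.* c) * y             ≤⟨ *-monoʳ-≤-nonNeg y (toℚ-mono-≤ bc≤da) ⟩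
    toℚ (d ℕ.* a) * y             ≡⟨ cong (_* y) (toℚ-* d a) ⟩
    toℚ d * toℚ a * y             ≡⟨ solve 3 (λ d a y → d :* a :* y := d :* y :* a) refl (toℚ d) (toℚ a) y ⟩
    toℚ d * y * toℚ a             ∎)
    where open ≤-Reasoning

  *-lower-bound : ∀ {p x c a e η} → .{{NonNegative c}} → p ≤ℚ x → x * c ≤ℚ a + e → e ≤ℚ η → p * c - η ≤ℚ a
  *-lower-bound {p} {x} {c} {a} {e} {η} p≤x xc≤a+e e≤η = begin
    p * c - η       ≤⟨ +-monoˡ-≤ (- η) (*-monoʳ-≤-nonNeg c p≤x) ⟩
    x * c - η       ≤⟨ +-monoˡ-≤ (- η) xc≤a+e ⟩
    (a + e) - η     ≤⟨ +-monoˡ-≤ (- η) (+-monoʳ-≤ a e≤η) ⟩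
    (a + η) - η     ≡⟨ solve 2 (λ a η → (a :+ η) :- η := a) refl a η ⟩
    a               ∎
    where open ≤-Reasoning

  ½ : ℚ
  ½ = + 1 / 2

  instance
    ½-positive : Positive ½
    ½-positive = _

    ½-nonNegative : NonNegative ½
    ½-nonNegative = _

  *½-toℚ-+-16* : ∀ a e → toℚ (a ℕ.+ 4 ℕ.* 4 ℕ.* e) * ½ ≡ toℚ a * ½ + toℚ (8 ℕ.* e)
  *½-toℚ-+-16* a e = begin-equality
    toℚ (a ℕ.+ 16 ℕ.* e) * ½
      ≡⟨ cong (_* ½) (trans (toℚ-+ a (16 ℕ.* e)) (cong (λ z → toℚ a + z) (toℚ-* 16 e))) ⟩
    (toℚ a + toℚ 16 * toℚ e) * ½
      ≡⟨ solve 4 (λ a s e h → (a :+ s :* e) :* h := a :* h :+ (s :* h) :* e) refl (toℚ a) (toℚ 16) (toℚ e) ½ ⟩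
    toℚ a * ½ + (toℚ 16 * ½) * toℚ e
      ≡⟨ cong (λ z → toℚ a * ½ + z) (sym (toℚ-* 8 e)) ⟩
    toℚ a * ½ + toℚ (8 ℕ.* e) ∎
    where open ≤-Reasoning

  -≤+ : ∀ q {ε δ} → .{{NonNegative ε}} → 0ℚ ≤ℚ δ → q - ε ≤ℚ q + δ
  -≤+ q {ε} 0≤δ = +-monoʳ-≤ q (≤-trans (neg-antimono-≤ (nonNegative⁻¹ ε)) 0≤δ)

module ExtremalGraphs where
  open import Data.Fin using (punchIn)
  open import Data.Nat using (suc; _+_; _*_; _^_; _≤_; s≤s; z≤n)
  open import Data.Nat.Combinatorics using (_C_)
  open import Data.Nat.Properties using (≤-trans; *-monoˡ-≤; m≤m+n; m≤n+m; m≤m*n; m^n>0)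
  open import Data.Product using (_,_; proj₁)
  import Data.Rational as ℚ
  import Data.Rational.Properties as ℚ
  open import Relation.Binary.PropositionalEquality using (cong; subst; subst₂; sym)
  open import Defs hiding (sym)
  open DensityArithmetic
  open PatternCounting
  open PathPattern
  open RationalBounds

  KFree-hereditary : ∀ r → Hereditary (KFree r)
  KFree-hereditary r H u = KFree-comap r (punchIn u) H

  copies-≤-extremal : ∀ r {n} (G : Graph n) → IsExtremal r G → ∀ H → KFree r H → copies P₃ H ≤ copies P₃ G
  copies-≤-extremal r G (_ , G-max) H H-free =
    subst₂ _≤_ (orderedP3≡copies H) (orderedP3≡copies G) (toℚ-cancel-≤ (ℚ.*-cancelʳ-≤-pos ½ (G-max H H-free)))

  extremal⇒density-≤-copiesAt : ∀ r {n} (G : Graph (suc n)) → IsExtremal r G → 4 ≤ suc n →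
    ∀ d (H : Graph (d + suc n)) → KFree r H → ∀ v →
    copies P₃ H * (n C 3) ≤ (copiesAt P₃ G v + 4 * 4 * suc n ^ 2) * ((d + suc n) C 4)
  extremal⇒density-≤-copiesAt r {n} G G-extremal 4≤n d H H-free v =
    let H′ , H′-free , shrink = copies-density-shrink P₃ (KFree r) (KFree-hereditary r) 4≤n d H H-free in
    density-≤-degree {N = suc n} {K = 4} {copies P₃ H} {copies P₃ G} {copiesAt P₃ G v + 4 * 4 * suc n ^ 2}
                     {suc n C 4} {(d + suc n) C 4} {n C 3}
      ([n+1]*nCk≡[k+1]*[n+1]C[k+1] n 3)
      (≤-trans shrink (*-monoˡ-≤ ((d + suc n) C 4) (copies-≤-extremal r G G-extremal H′ H′-free)))
      (clone-maximal⇒copies-≤-copiesAt P₃ G clone-maximal v)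
    where
    clone-maximal : ∀ v w → copies P₃ (clone G v w) ≤ copies P₃ G
    clone-maximal v w =
      copies-≤-extremal r G G-extremal (clone G v w) (KFree-comap r (redirect v w) G (proj₁ G-extremal))

  νP3at-lower-bound : ∀ r {n} (G : Graph (suc n)) → IsExtremal (suc r) G → 8 * suc r ^ 4 ≤ suc n →
    ∀ v q → BelowOPT (suc r) q →
    (q ℚ.- recip (suc r ^ 10)) ℚ.* toℚ (n C 3) ℚ.- recip (suc r ^ 4) ℚ.* toℚ (suc n ^ 3) ℚ.≤ νP3at G v
  νP3at-lower-bound r {n} G G-extremal n₀≤n v q (δ , 0<δ , N , dense) =
    ℚ.≤-trans (*-lower-bound {{toℚ-nonNeg (n C 3)}} q-ε≤q+δ average-bound error-bound)
              (ℚ.≤-reflexive (cong (λ a → toℚ a ℚ.* ½) (sym (orderedP3at≡copiesAt G v))))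
    where
    q-ε≤q+δ : q ℚ.- recip (suc r ^ 10) ℚ.≤ q ℚ.+ δ
    q-ε≤q+δ = -≤+ q {{recip-nonNeg (suc r ^ 10)}} (ℚ.<⇒≤ 0<δ)
    4≤n : 4 ≤ suc n
    4≤n = ≤-trans (≤-trans (s≤s (s≤s (s≤s (s≤s z≤n)))) (m≤m*n 8 (suc r ^ 4))) n₀≤n
    average-bound : (q ℚ.+ δ) ℚ.* toℚ (n C 3) ℚ.≤ toℚ (copiesAt P₃ G v) ℚ.* ½ ℚ.+ toℚ (8 * suc n ^ 2)
    average-bound =
      let H , H-free , H-dense = dense (N + suc n) (m≤m+n N (suc n)) in
      subst ((q ℚ.+ δ) ℚ.* toℚ (n C 3) ℚ.≤_) (*½-toℚ-+-16* (copiesAt P₃ G v) (suc n ^ 2))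
        (*-≤-transfer (q ℚ.+ δ) ½ {(N + suc n) C 4} {copies P₃ H} {n C 3} {copiesAt P₃ G v + 4 * 4 * suc n ^ 2}
          (0<nCk (≤-trans 4≤n (m≤n+m (suc n) N)))
          (subst (λ T → (q ℚ.+ δ) ℚ.* toℚ ((N + suc n) C 4) ℚ.≤ toℚ T ℚ.* ½) (orderedP3≡copies H) H-dense)
          (extremal⇒density-≤-copiesAt (suc r) G G-extremal 4≤n N H H-free v))
    error-bound : toℚ (8 * suc n ^ 2) ℚ.≤ recip (suc r ^ 4) ℚ.* toℚ (suc n ^ 3)
    error-bound = toℚ-≤-recip-* {8 * suc n ^ 2} {suc n ^ 3} {suc r ^ 4} (m^n>0 (suc r) 4)
                                (a*b≤n⇒a*n²*b≤n³ {8} {suc r ^ 4} {suc n} n₀≤n)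

open import Defs
open import Data.Nat using (ℕ; zero; suc; _≤_; _^_; _∸_)
import Data.Nat as ℕ
open import Data.Nat.Combinatorics using (_C_)
open import Data.Fin using (Fin)
open import Data.Product using (∃; _,_)
open import Data.Rational using (ℚ; _*_; _-_) renaming (_≤_ to _≤ℚ_)
open ExtremalGraphs using (νP3at-lower-bound)

proposition4p1 : (r : ℕ) → 4 ≤ r → ∃ λ (n₀ : ℕ) → ∀ (n : ℕ) → n₀ ≤ n →
    (G : Graph n) → IsExtremal r G → (v : Fin n) → (q : ℚ) → BelowOPT r q →
    (q - recip (r ^ 10)) * toℚ ((n ∸ 1) C 3) - recip (r ^ 4) * toℚ (n ^ 3) ≤ℚ νP3at G v
proposition4p1 (suc r) _ = 8 ℕ.* suc r ^ 4 , λ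
  { zero    ()
  ; (suc n) n₀≤n G G-extremal → νP3at-lower-bound r G G-extremal n₀≤n
  }
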